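{- Let $k\ge0$ be an integer and $G$ a graph. If $\max\rho(G)>k$ and $\max\rho(G-v)\le k$ for every vertex $v$ of $G$, then $|V(G)|=2k+2$.
   Context: Graphs are finite and simple. $\rho_G(X)$ is the binary rank of the $X\times(V(G)\setminus X)$ matrix with $(i,j)$-entry $1$ iff $i,j$ adjacent; $\max\rho(G)=\max_{S\subseteq V(G)}\rho_G(S)$. -}

module Defs where

open import Data.Nat using (ℕ; zero; suc; pred)
open import Data.Bool using (Bool; true; false; _xor_)
open import Data.Fin using (Fin; punchIn)
open import Data.Fin.Subset using (Subset; _∈_; _∉_)
open import Data.List using (List; []; _∷_; length)
open import Data.List.Relation.Unary.Unique.Propositional using (Unique)
open import Data.Vec using (Vec; []; _∷_)
open import Data.Vec.Relation.Unary.All using (All)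
open import Data.Product using (Σ; _×_; ∃-syntax)
open import Relation.Binary.PropositionalEquality using (_≡_)

record Graph (n : ℕ) : Set where
  field
    adj    : Fin n → Fin n → Bool
    sym    : ∀ i j → adj i j ≡ adj j i
    irrefl : ∀ i → adj i i ≡ false
open Graph public

_-_ : ∀ {n} → Graph n → Fin n → Graph (pred n)
_-_ {suc m} G v = record
  { adj    = λ i j → adj G (punchIn v i) (punchIn v j)
  ; sym    = λ i j → sym G (punchIn v i) (punchIn v j)
  ; irrefl = λ i → irrefl G (punchIn v i) }

-- Matrices over GF(2) = Bool (with xor as addition), with arbitrary
-- row index type R and column index type C.
combo : ∀ {R C : Set} → (C → R → Bool) → (rows : List R) → Vec Bool (length rows) → C → Bool
combo M [] [] j = false
combo M (r ∷ rs) (false ∷ cs) j = combo M rs cs j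
combo M (r ∷ rs) (true ∷ cs) j = M j r xor combo M rs cs j

LinIndepRows : ∀ {R C : Set} → (R → C → Bool) → List R → Set
LinIndepRows {R} {C} M rows =
  (c : Vec Bool (length rows)) →
  (∀ (j : C) → combo (λ j' r → M r j') rows c j ≡ false) →
  All (_≡ false) c

IsBinaryRank : ∀ {R C : Set} → (R → C → Bool) → ℕ → Set
IsBinaryRank {R} {C} M r =
  (∃[ rows ] (Unique rows × LinIndepRows M rows × length rows ≡ r)) ×
  (∀ (rows : List R) → Unique rows → LinIndepRows M rows → length rows Data.Nat.≤ r)

cutMatrix : ∀ {n} → Graph n → (X : Subset n) →
  Σ (Fin n) (λ i → i ∈ X) → Σ (Fin n) (λ j → j ∉ X) → Bool
cutMatrix G X (i Data.Product., _) (j Data.Product., _) = adj G i j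

IsCutRank : ∀ {n} → Graph n → Subset n → ℕ → Set
IsCutRank G X r = IsBinaryRank (cutMatrix G X) r

MaxRhoGt : ∀ {n} → Graph n → ℕ → Set
MaxRhoGt {n} G k = ∃[ X ] ∃[ r ] (IsCutRank G X r × k Data.Nat.< r)

MaxRhoLe : ∀ {n} → Graph n → ℕ → Set
MaxRhoLe {n} G k = ∀ (X : Subset n) (r : ℕ) → IsCutRank G X r → r Data.Nat.≤ k

module Submission where

-- Take X with ρ(X) > k and k + 1 independent rows of the X × (V ∖ X) matrix. Row rank is at most
-- column rank, so the (V ∖ X) × X matrix also has k + 1 independent rows. A vertex v of X that is
-- not one of the chosen rows is not a column either, so deleting it keeps the rows independent and
-- ρ_{G-v}(X - v) > k, against minimality. Hence X consists of exactly the k + 1 chosen vertices,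
-- likewise V ∖ X, and |V| = 2k + 2. The rank inequalities are proved by counting: a map from
-- GF(2)^q to GF(2)^p that is injective forces q ≤ p.

open import Defs
open import Data.Nat using (ℕ; _+_; _*_)
open import Data.Fin using (Fin)
open import Relation.Binary.PropositionalEquality using (_≡_)

open import Algebra.Bundles using (CommutativeRing)
open import Data.Bool using (Bool; true; false; _xor_)
import Data.Bool.Properties as Bool
open import Data.Bool.Properties using (xor-same; xor-assoc; xor-identityʳ; xor-∧-commutativeRing)
open import Data.Empty using (⊥-elim)
open import Data.Fin using (zero; suc; combine; remQuot; punchIn; punchOut) renaming (_≟_ to _≟ᶠ_)
open import Data.Fin.Properties
  using (2↔Bool; remQuot-combine; combine-remQuot; injective⇒≤; all?; ¬∀⟶∃¬; punchIn-punchOut)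
open import Data.Fin.Subset using (Subset; ∁) renaming (_∈_ to _∈ˢ_; _∉_ to _∉ˢ_)
open import Data.Fin.Subset.Properties using (_∈?_; x∈p⇒x∉∁p; x∉p⇒x∈∁p; x∈∁p⇒x∉p)
open import Data.List using (List; []; _∷_; length; _++_; lookup; take; allFin)
open import Data.List.Properties using (length-++; length-map; length-take)
open import Data.List.Membership.Propositional using () renaming (_∈_ to _∈ₗ_)
open import Data.List.Membership.Propositional.Properties
  using (∈-map⁻; ∈-++⁺ˡ; ∈-++⁺ʳ; ∈-lookup; ∈-allFin)
open import Data.List.Relation.Binary.Pointwise using (Pointwise; []; _∷_; Pointwise-length)
open import Data.List.Relation.Binary.Sublist.Propositional
  using (_⊆_; []; _∷_; _∷ʳ_; ⊆-refl; ⊆-trans; from∈)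
open import Data.List.Relation.Binary.Sublist.Propositional.Properties using (take-⊆; length-mono-≤)
import Data.List.Relation.Unary.All as List
open List.All using ([]; _∷_)
open import Data.List.Relation.Unary.All.Properties using (¬Any⇒All¬)
open import Data.List.Relation.Unary.AllPairs using (AllPairs; []; _∷_)
import Data.List.Relation.Unary.AllPairs as AllPairs
import Data.List.Relation.Unary.AllPairs.Properties as AllPairs
open import Data.List.Relation.Unary.Any using (here; there; index; any?)
import Data.List.Relation.Unary.Any.Properties as Any
open import Data.List.Relation.Unary.Any.Properties using (lookup-index)
open import Data.List.Relation.Unary.Unique.Propositional using (Unique)
import Data.List.Relation.Unary.Unique.Propositional.Properties as Unique
open import Data.Nat using (zero; suc; _^_; _≤_; _<_; s≤s; z≤n)
open import Data.Nat.Properties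
  using (≮⇒≥; <⇒≱; ^-monoʳ-<; m≤n⇒m⊓n≡m; ≤-antisym; <-≤-trans; ≤-trans; n≮n; ≤-refl)
open import Data.Nat.Tactic.RingSolver using (solve-∀)
open import Data.Product using (Σ; _,_; proj₁; proj₂; ∃; _×_)
open import Data.Sum using (_⊎_; inj₁; inj₂)
open import Data.Vec using (Vec; []; _∷_; replicate; zipWith; map; fromList; removeAt)
open import Data.Vec.Properties using (map-const; map-cong; removeAt-punchOut; []=⇒lookup; lookup⇒[]=)
import Data.Vec.Relation.Unary.All as All
open All using (All; []; _∷_)
open import Function using (_∘_; Inverse)
open import Level using (0ℓ)
open import Relation.Binary.PropositionalEquality using (_≢_; refl; trans; cong; cong₂; subst)
import Relation.Binary.PropositionalEquality as ≡
open import Relation.Nullary using (¬_; yes; no; ¬?)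
open import Relation.Nullary.Decidable using (_→-dec_)
open import Relation.Unary using (Pred; Decidable)
open import Algebra.Properties.CommutativeSemigroup
  (CommutativeRing.+-commutativeSemigroup xor-∧-commutativeRing) using (interchange; x∙yz≈y∙xz)

-- Vectors over GF(2)

infixl 6 _⊕_
infix 7 _·_

_·_ : ∀ {q} → Vec Bool q → Vec Bool q → Bool
[]          · []      = false
(false ∷ c) · (_ ∷ v) = c · v
(true  ∷ c) · (x ∷ v) = x xor c · v

_⊕_ : ∀ {q} → Vec Bool q → Vec Bool q → Vec Bool q
_⊕_ = zipWith _xor_

0ᵛ : ∀ {q} → Vec Bool q
0ᵛ = replicate _ false

·-zeroˡ : ∀ {q} (v : Vec Bool q) → 0ᵛ · v ≡ false
·-zeroˡ []      = refl
·-zeroˡ (_ ∷ v) = ·-zeroˡ v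

·-zeroʳ : ∀ {q} (c : Vec Bool q) → c · 0ᵛ ≡ false
·-zeroʳ []          = refl
·-zeroʳ (false ∷ c) = ·-zeroʳ c
·-zeroʳ (true  ∷ c) = ·-zeroʳ c

·-distribʳ-⊕ : ∀ {q} (a b v : Vec Bool q) → (a ⊕ b) · v ≡ a · v xor b · v
·-distribʳ-⊕ []          []          []      = refl
·-distribʳ-⊕ (false ∷ a) (false ∷ b) (x ∷ v) = ·-distribʳ-⊕ a b v
·-distribʳ-⊕ (true  ∷ a) (false ∷ b) (x ∷ v) =
  trans (cong (x xor_) (·-distribʳ-⊕ a b v)) (≡.sym (xor-assoc x (a · v) (b · v)))
·-distribʳ-⊕ (false ∷ a) (true  ∷ b) (x ∷ v) =
  trans (cong (x xor_) (·-distribʳ-⊕ a b v)) (x∙yz≈y∙xz x (a · v) (b · v))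
·-distribʳ-⊕ (true  ∷ a) (true  ∷ b) (x ∷ v) =
  trans (·-distribʳ-⊕ a b v)
        (≡.sym (trans (interchange x (a · v) x (b · v)) (cong (_xor (a · v xor b · v)) (xor-same x))))

·-distribˡ-⊕ : ∀ {q} (c u v : Vec Bool q) → c · (u ⊕ v) ≡ c · u xor c · v
·-distribˡ-⊕ []          []      []      = refl
·-distribˡ-⊕ (false ∷ c) (_ ∷ u) (_ ∷ v) = ·-distribˡ-⊕ c u v
·-distribˡ-⊕ (true  ∷ c) (x ∷ u) (y ∷ v) =
  trans (cong ((x xor y) xor_) (·-distribˡ-⊕ c u v)) (interchange x y (c · u) (c · v))

⊕-vanishes⇒≡ : ∀ {q} (c c′ : Vec Bool q) → All (_≡ false) (c ⊕ c′) → c ≡ c′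
⊕-vanishes⇒≡ []          []           []       = refl
⊕-vanishes⇒≡ (false ∷ c) (false ∷ c′) (_ ∷ ps) = cong (false ∷_) (⊕-vanishes⇒≡ c c′ ps)
⊕-vanishes⇒≡ (true  ∷ c) (true  ∷ c′) (_ ∷ ps) = cong (true ∷_) (⊕-vanishes⇒≡ c c′ ps)
⊕-vanishes⇒≡ (false ∷ c) (true  ∷ c′) (() ∷ _)
⊕-vanishes⇒≡ (true  ∷ c) (false ∷ c′) (() ∷ _)

≡⇒xor≡false : ∀ {a b} → a ≡ b → a xor b ≡ false
≡⇒xor≡false {a} refl = xor-same a

xor≡false⇒≡ : ∀ {a b} → a xor b ≡ false → a ≡ b
xor≡false⇒≡ {false} {false} _ = refl
xor≡false⇒≡ {true}  {true}  _ = refl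

encode : ∀ {q} → Vec Bool q → Fin (2 ^ q)
encode []      = zero
encode (b ∷ v) = combine (Inverse.from 2↔Bool b) (encode v)

decode : ∀ {q} → Fin (2 ^ q) → Vec Bool q
decode {zero}  _ = []
decode {suc q} i = Inverse.to 2↔Bool (proj₁ (remQuot {2} (2 ^ q) i)) ∷ decode (proj₂ (remQuot {2} (2 ^ q) i))

decode-encode : ∀ {q} (v : Vec Bool q) → decode (encode v) ≡ v
decode-encode []      = refl
decode-encode {suc q} (b ∷ v) =
  trans (cong (λ r → Inverse.to 2↔Bool (proj₁ r) ∷ decode (proj₂ r))
              (remQuot-combine {2} {2 ^ q} (Inverse.from 2↔Bool b) (encode v)))
        (cong₂ _∷_ (Inverse.strictlyInverseˡ 2↔Bool b) (decode-encode v))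

encode-decode : ∀ {q} (i : Fin (2 ^ q)) → encode (decode {q} i) ≡ i
encode-decode {zero}  zero = refl
encode-decode {suc q} i =
  trans (cong₂ combine (Inverse.strictlyInverseʳ 2↔Bool (proj₁ (remQuot {2} (2 ^ q) i)))
                       (encode-decode {q} (proj₂ (remQuot {2} (2 ^ q) i))))
        (combine-remQuot {2} (2 ^ q) i)

encode-injective : ∀ {q} {u v : Vec Bool q} → encode u ≡ encode v → u ≡ v
encode-injective {u = u} {v} eq = trans (≡.sym (decode-encode u)) (trans (cong decode eq) (decode-encode v))

decode-injective : ∀ {q} {i j : Fin (2 ^ q)} → decode {q} i ≡ decode {q} j → i ≡ j
decode-injective {q} {i} {j} eq = trans (≡.sym (encode-decode {q} i)) (trans (cong encode eq) (encode-decode {q} j))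

injective⇒length≤ : ∀ {q p} (F : Vec Bool q → Vec Bool p) →
  (∀ c c′ → F c ≡ F c′ → c ≡ c′) → q ≤ p
injective⇒length≤ {q} {p} F F-injective =
  ≮⇒≥ λ p<q → <⇒≱ (^-monoʳ-< 2 (s≤s (s≤s z≤n)) p<q) 2^q≤2^p
  where
  2^q≤2^p : 2 ^ q ≤ 2 ^ p
  2^q≤2^p = injective⇒≤ {f = encode ∘ F ∘ decode {q}} λ eq →
    decode-injective (F-injective _ _ (encode-injective eq))

∀-or-counterexample : ∀ {q} {P : Vec Bool q → Set} → Decidable P → (∀ v → P v) ⊎ ∃ λ v → ¬ P v
∀-or-counterexample {q} {P} P? with all? (P? ∘ decode)
... | yes ∀P = inj₁ λ v → subst P (decode-encode v) (∀P (encode v))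
... | no ¬∀P with ¬∀⟶∃¬ (2 ^ q) (P ∘ decode) (P? ∘ decode) ¬∀P
...   | i , ¬Pi = inj₂ (decode i , ¬Pi)

map-⊕ : ∀ {A : Set} {q} (f g : A → Bool) (w : Vec A q) → map (λ a → f a xor g a) w ≡ map f w ⊕ map g w
map-⊕ f g []      = refl
map-⊕ f g (a ∷ w) = cong (_ ∷_) (map-⊕ f g w)

·-swap : ∀ {A B : Set} {p q} (F : A → B → Bool)
  (c : Vec Bool p) (u : Vec A p) (β : Vec Bool q) (w : Vec B q) →
  c · map (λ a → β · map (F a) w) u ≡ β · map (λ b → c · map (λ a → F a b) u) w
·-swap F []          []      β w = ≡.sym (trans (cong (β ·_) (map-const w false)) (·-zeroʳ β))
·-swap F (false ∷ c) (_ ∷ u) β w = ·-swap F c u β w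
·-swap F (true  ∷ c) (a ∷ u) β w =
  trans (cong (β · map (F a) w xor_) (·-swap F c u β w))
        (≡.sym (trans (cong (β ·_) (map-⊕ (F a) _ w)) (·-distribˡ-⊕ β (map (F a) w) _)))

-- Independent rows of a matrix over GF(2)

module _ {R C : Set} (M : R → C → Bool) where

  column : (xs : List R) → C → Vec Bool (length xs)
  column xs j = map (λ x → M x j) (fromList xs)

  Vanishes : (xs : List R) → Vec Bool (length xs) → Set
  Vanishes xs c = ∀ j → c · column xs j ≡ false

  Independent : List R → Set
  Independent xs = ∀ c → Vanishes xs c → All (_≡ false) c

  combo≡· : ∀ xs c j → combo (λ j′ r → M r j′) xs c j ≡ c · column xs j
  combo≡· []       []          j = refl
  combo≡· (x ∷ xs) (false ∷ c) j = combo≡· xs c j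
  combo≡· (x ∷ xs) (true  ∷ c) j = cong (M x j xor_) (combo≡· xs c j)

  linIndepRows⇒independent : ∀ {xs : List R} → LinIndepRows M xs → Independent xs
  linIndepRows⇒independent {xs} li c v = li c λ j → trans (combo≡· xs c j) (v j)

  independent⇒linIndepRows : ∀ {xs : List R} → Independent xs → LinIndepRows M xs
  independent⇒linIndepRows {xs} ind c v = ind c λ j → trans (≡.sym (combo≡· xs c j)) (v j)

  extend : ∀ {xs ys : List R} → xs ⊆ ys → Vec Bool (length xs) → Vec Bool (length ys)
  extend []          []      = []
  extend (y ∷ʳ xs⊆ys) c       = false ∷ extend xs⊆ys c
  extend (_ ∷ xs⊆ys)  (b ∷ c) = b ∷ extend xs⊆ys c

  extend-· : ∀ {xs ys} (xs⊆ys : xs ⊆ ys) c j → extend xs⊆ys c · column ys j ≡ c · column xs j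
  extend-· []              []          j = refl
  extend-· (y ∷ʳ xs⊆ys)    c           j = extend-· xs⊆ys c j
  extend-· (refl ∷ xs⊆ys)  (false ∷ c) j = extend-· xs⊆ys c j
  extend-· {x ∷ _} (refl ∷ xs⊆ys)  (true  ∷ c) j = cong (M x j xor_) (extend-· xs⊆ys c j)

  extend-zero⁻ : ∀ {xs ys} (xs⊆ys : xs ⊆ ys) c → All (_≡ false) (extend xs⊆ys c) → All (_≡ false) c
  extend-zero⁻ []           []      _        = []
  extend-zero⁻ (y ∷ʳ xs⊆ys) c       (_ ∷ ps) = extend-zero⁻ xs⊆ys c ps
  extend-zero⁻ (_ ∷ xs⊆ys)  (b ∷ c) (p ∷ ps) = p ∷ extend-zero⁻ xs⊆ys c ps

  independent-⊆ : ∀ {xs ys : List R} → xs ⊆ ys → Independent ys → Independent xs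
  independent-⊆ xs⊆ys ind c v =
    extend-zero⁻ xs⊆ys c (ind (extend xs⊆ys c) λ j → trans (extend-· xs⊆ys c j) (v j))

  SameRow : R → R → Set
  SameRow x y = ∀ j → M x j ≡ M y j

  independent-pair⇒¬SameRow : ∀ {x y : R} → Independent (x ∷ y ∷ []) → ¬ SameRow x y
  independent-pair⇒¬SameRow {x} {y} ind x≈y with ind (true ∷ true ∷ []) pair-vanishes
    where
    pair-vanishes : Vanishes (x ∷ y ∷ []) (true ∷ true ∷ [])
    pair-vanishes j =
      trans (cong (M x j xor_) (trans (xor-identityʳ (M y j)) (≡.sym (x≈y j)))) (xor-same (M x j))
  ... | () ∷ _

  independent⇒distinct : ∀ {xs : List R} → Independent xs → AllPairs (λ x y → ¬ SameRow x y) xs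
  independent⇒distinct {[]}     _   = []
  independent⇒distinct {x ∷ xs} ind =
    List.tabulate (λ y∈xs → independent-pair⇒¬SameRow (independent-⊆ (refl ∷ from∈ y∈xs) ind)) ∷
    independent⇒distinct (independent-⊆ (x ∷ʳ ⊆-refl) ind)

  independent-factors⇒length≤ : ∀ {xs : List R} {p} → Independent xs →
    (K : Vec Bool (length xs) → Vec Bool p) →
    (∀ c c′ → K c ≡ K c′ → ∀ j → c · column xs j ≡ c′ · column xs j) → length xs ≤ p
  independent-factors⇒length≤ {xs} ind K K-determines = injective⇒length≤ K λ c c′ Kc≡Kc′ →
    ⊕-vanishes⇒≡ c c′ (ind (c ⊕ c′) λ j →
      trans (·-distribʳ-⊕ c c′ (column xs j)) (≡⇒xor≡false (K-determines c c′ Kc≡Kc′ j)))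

  independent⇒Unique : ∀ {xs : List R} → Independent xs → Unique xs
  independent⇒Unique ind =
    AllPairs.map (λ x≉y x≡y → x≉y λ j → cong (λ z → M z j) x≡y) (independent⇒distinct ind)

  InSpan : List R → R → Set
  InSpan ys r = ∃ λ β → ∀ j → M r j ≡ β · column ys j

  vanishing-∷⇒InSpan : ∀ {xs : List R} {r c} → Independent xs →
    Vanishes (r ∷ xs) c → ¬ All (_≡ false) c → InSpan xs r
  vanishing-∷⇒InSpan {c = false ∷ c} ind v c≢0 = ⊥-elim (c≢0 (refl ∷ ind c v))
  vanishing-∷⇒InSpan {c = true  ∷ c} ind v c≢0 = c , λ j → xor≡false⇒≡ (v j)

  InSpan-self : ∀ (xs : List R) r → InSpan (r ∷ xs) r
  InSpan-self xs r = true ∷ 0ᵛ , λ j →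
    ≡.sym (trans (cong (M r j xor_) (·-zeroˡ (column xs j))) (xor-identityʳ (M r j)))

  InSpan-⊆ : ∀ {xs ys : List R} {r} → xs ⊆ ys → InSpan xs r → InSpan ys r
  InSpan-⊆ xs⊆ys (β , r≡β·) = extend xs⊆ys β , λ j → trans (r≡β· j) (≡.sym (extend-· xs⊆ys β j))

  []-independent : Independent []
  []-independent [] _ = []

  independent-of-length : ∀ {xs : List R} {ℓ} → Independent xs → ℓ ≤ length xs →
    ∃ λ ys → Independent ys × length ys ≡ ℓ
  independent-of-length {xs} {ℓ} ind ℓ≤ =
    take ℓ xs , independent-⊆ (take-⊆ ℓ xs) ind , trans (length-take ℓ xs) (m≤n⇒m⊓n≡m ℓ≤)

  module _ {ys : List R} (spans : ∀ r → InSpan ys r) where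

    reexpress : (xs : List R) → Vec Bool (length xs) → Vec Bool (length ys)
    reexpress []       []          = 0ᵛ
    reexpress (x ∷ xs) (false ∷ c) = reexpress xs c
    reexpress (x ∷ xs) (true  ∷ c) = proj₁ (spans x) ⊕ reexpress xs c

    reexpress-· : ∀ (xs : List R) c j → c · column xs j ≡ reexpress xs c · column ys j
    reexpress-· []       []          j = ≡.sym (·-zeroˡ (column ys j))
    reexpress-· (x ∷ xs) (false ∷ c) j = reexpress-· xs c j
    reexpress-· (x ∷ xs) (true  ∷ c) j =
      trans (cong₂ _xor_ (proj₂ (spans x) j) (reexpress-· xs c j))
            (≡.sym (·-distribʳ-⊕ (proj₁ (spans x)) (reexpress xs c) (column ys j)))

    independent≤spanning : ∀ {xs : List R} → Independent xs → length xs ≤ length ys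
    independent≤spanning {xs} ind = independent-factors⇒length≤ ind (reexpress xs) λ c c′ eq j →
      trans (reexpress-· xs c j) (trans (cong (_· column ys j) eq) (≡.sym (reexpress-· xs c′ j)))

module _ {R C R′ C′ : Set} (M : R → C → Bool) (N : R′ → C′ → Bool)
         (f : C → R′) (g : R → C′) (M≡Nᵀ : ∀ x j → M x j ≡ N (f j) (g x)) where

  independent≤spanning-transpose : ∀ {xs : List R} {ys : List R′} →
    Independent M xs → (∀ r → InSpan N ys r) → length xs ≤ length ys
  independent≤spanning-transpose {xs} {ys} ind spans =
    independent-factors⇒length≤ M ind K λ c c′ Kc≡Kc′ j →
      trans (through-K c j) (trans (cong (proj₁ (spans (f j)) ·_) Kc≡Kc′) (≡.sym (through-K c′ j)))
    where
    -- Every column of M is a combination of the rows ys of N, so K c determines all column sums of c.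
    K : Vec Bool (length xs) → Vec Bool (length ys)
    K c = map (λ s → c · map (λ x → N s (g x)) (fromList xs)) (fromList ys)

    through-K : ∀ c j → c · column M xs j ≡ proj₁ (spans (f j)) · K c
    through-K c j = trans
      (cong (c ·_) (map-cong (λ x → trans (M≡Nᵀ x j) (proj₂ (spans (f j)) (g x))) (fromList xs)))
      (·-swap (λ x s → N s (g x)) c (fromList xs) (proj₁ (spans (f j))) (fromList ys))

module _ {R C R′ C′ : Set} (M : R → C → Bool) (M′ : R′ → C′ → Bool) (P : R → R′ → Set)
         (h : C → C′) (entries : ∀ {x y} → P x y → ∀ j → M x j ≡ M′ y (h j)) where

  relabel : ∀ {xs ys} → Pointwise P xs ys → Vec Bool (length ys) → Vec Bool (length xs)
  relabel []         []      = []
  relabel (_ ∷ xs~ys) (b ∷ c) = b ∷ relabel xs~ys c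

  relabel-· : ∀ {xs ys} (xs~ys : Pointwise P xs ys) c j →
    relabel xs~ys c · column M xs j ≡ c · column M′ ys (h j)
  relabel-· []            []          j = refl
  relabel-· (_   ∷ xs~ys) (false ∷ c) j = relabel-· xs~ys c j
  relabel-· (Pxy ∷ xs~ys) (true  ∷ c) j = cong₂ _xor_ (entries Pxy j) (relabel-· xs~ys c j)

  relabel-zero⁻ : ∀ {xs ys} (xs~ys : Pointwise P xs ys) c →
    All (_≡ false) (relabel xs~ys c) → All (_≡ false) c
  relabel-zero⁻ []          []      _        = []
  relabel-zero⁻ (_ ∷ xs~ys) (b ∷ c) (p ∷ ps) = p ∷ relabel-zero⁻ xs~ys c ps

  independent-relabel : ∀ {xs ys} → Pointwise P xs ys → Independent M xs → Independent M′ ys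
  independent-relabel xs~ys ind c v =
    relabel-zero⁻ xs~ys c (ind (relabel xs~ys c) λ j → trans (relabel-· xs~ys c j) (v (h j)))

-- Matrices with finitely many rows and columns

module _ {m n : ℕ} {P : Pred (Fin m) 0ℓ} {Q : Pred (Fin n) 0ℓ} (P? : Decidable P) (Q? : Decidable Q)
         (a : Fin m → Fin n → Bool) where

  -- Entries depend only on the underlying indices, so vanishing is decidable; cutMatrix G Z is
  -- definitionally of this form.
  restrict : Σ (Fin m) P → Σ (Fin n) Q → Bool
  restrict x j = a (proj₁ x) (proj₁ j)

  vanishes? : ∀ (xs : List (Σ (Fin m) P)) → Decidable (Vanishes restrict xs)
  vanishes? xs c with all? (λ i → Q? i →-dec (c · map (λ x → a (proj₁ x) i) (fromList xs) Bool.≟ false))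
  ... | yes v = yes λ j → v (proj₁ j) (proj₂ j)
  ... | no ¬v = no λ v → ¬v λ i q → v (i , q)

  independent-∷-or-InSpan : ∀ {xs} r → Independent restrict xs →
    Independent restrict (r ∷ xs) ⊎ InSpan restrict xs r
  independent-∷-or-InSpan {xs} r ind
    with ∀-or-counterexample (λ c → vanishes? (r ∷ xs) c →-dec All.all? (Bool._≟ false) c)
  ... | inj₁ r∷xs-independent = inj₁ r∷xs-independent
  ... | inj₂ (c , ¬implication) with vanishes? (r ∷ xs) c
  ...   | yes v = inj₂ (vanishing-∷⇒InSpan restrict {r = r} {c} ind v λ c≡0 → ¬implication λ _ → c≡0)
  ...   | no ¬v = ⊥-elim (¬implication λ v → ⊥-elim (¬v v))

  absorb : ∀ {xs} r → Independent restrict xs →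
    ∃ λ ys → Independent restrict ys × xs ⊆ ys × InSpan restrict ys r
  absorb {xs} r ind with independent-∷-or-InSpan r ind
  ... | inj₁ ind′ = r ∷ xs , ind′ , r ∷ʳ ⊆-refl , InSpan-self restrict xs r
  ... | inj₂ r∈⟨xs⟩ = xs , ind , ⊆-refl , r∈⟨xs⟩

  absorb-all : ∀ {xs} (is : List (Fin m)) → Independent restrict xs →
    ∃ λ ys → Independent restrict ys × xs ⊆ ys ×
             (∀ {i} → i ∈ₗ is → (p : P i) → InSpan restrict ys (i , p))
  absorb-all {xs} [] ind = xs , ind , ⊆-refl , λ ()
  absorb-all (i ∷ is) ind with absorb-all is ind | P? i
  ... | ys , ind′ , xs⊆ys , spans | no ¬p = ys , ind′ , xs⊆ys , λ
    { (here refl) p → ⊥-elim (¬p p)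
    ; (there i∈is) → spans i∈is }
  ... | ys , ind′ , xs⊆ys , spans | yes p with absorb (i , p) ind′
  ...   | zs , ind″ , ys⊆zs , i∈⟨zs⟩ = zs , ind″ , ⊆-trans xs⊆ys ys⊆zs , λ
    { (here refl) _ → i∈⟨zs⟩
    ; {i′} (there i∈is) p′ → InSpan-⊆ restrict {r = i′ , p′} ys⊆zs (spans i∈is p′) }

  independent⇒spanning-extension : ∀ {xs} → Independent restrict xs →
    ∃ λ ys → Independent restrict ys × length xs ≤ length ys × (∀ r → InSpan restrict ys r)
  independent⇒spanning-extension ind with absorb-all (allFin m) ind
  ... | ys , ind′ , xs⊆ys , spans =
    ys , ind′ , length-mono-≤ xs⊆ys , λ (i , p) → spans (∈-allFin i) p

  independent⇒rank≥ : ∀ {xs} → Independent restrict xs →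
    ∃ λ t → IsBinaryRank restrict t × length xs ≤ t
  independent⇒rank≥ ind with independent⇒spanning-extension ind
  ... | ys , ind′ , xs≤ys , spans =
    length ys ,
    (  (ys , independent⇒Unique restrict ind′ , independent⇒linIndepRows restrict ind′ , refl)
    , λ rows _ li → independent≤spanning restrict spans (linIndepRows⇒independent restrict {rows} li)) ,
    xs≤ys

-- Cut-rank

vertices : ∀ {n} {P : Pred (Fin n) 0ℓ} → List (Σ (Fin n) P) → List (Fin n)
vertices = Data.List.map proj₁

vertices-⊆ : ∀ {n} {P : Pred (Fin n) 0ℓ} {xs : List (Σ (Fin n) P)} {v} → v ∈ₗ vertices xs → P v
vertices-⊆ v∈xs with ∈-map⁻ proj₁ v∈xs
... | (_ , Pv) , _ , refl = Pv

module _ {m : ℕ} (Z : Subset (suc m)) {v : Fin (suc m)} where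

  punchOut-∈ : ∀ {i} (v≢i : v ≢ i) → i ∈ˢ Z → punchOut v≢i ∈ˢ removeAt Z v
  punchOut-∈ v≢i i∈Z = lookup⇒[]= _ _ (trans (removeAt-punchOut Z v≢i) ([]=⇒lookup i∈Z))

  punchOut-∉ : ∀ {i} (v≢i : v ≢ i) → i ∉ˢ Z → punchOut v≢i ∉ˢ removeAt Z v
  punchOut-∉ v≢i i∉Z i∈Z′ =
    i∉Z (lookup⇒[]= _ _ (trans (≡.sym (removeAt-punchOut Z v≢i)) ([]=⇒lookup i∈Z′)))

  SurvivingRow : Σ (Fin (suc m)) (_∈ˢ Z) → Σ (Fin m) (_∈ˢ removeAt Z v) → Set
  SurvivingRow x y = punchIn v (proj₁ y) ≡ proj₁ x

  surviving-rows : (xs : List (Σ (Fin (suc m)) (_∈ˢ Z))) → List.All (λ x → v ≢ proj₁ x) xs →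
    ∃ (Pointwise SurvivingRow xs)
  surviving-rows []       []           = [] , []
  surviving-rows (x ∷ xs) (v≢x ∷ v∉xs) with surviving-rows xs v∉xs
  ... | ys , xs~ys = (punchOut v≢x , punchOut-∈ v≢x (proj₂ x)) ∷ ys , punchIn-punchOut v≢x ∷ xs~ys

  independent-removeAt : (G : Graph (suc m)) {xs : List (Σ (Fin (suc m)) (_∈ˢ Z))} →
    v ∈ˢ Z → List.All (λ x → v ≢ proj₁ x) xs → Independent (cutMatrix G Z) xs →
    ∃ λ ys → Independent (cutMatrix (G - v) (removeAt Z v)) ys × length ys ≡ length xs
  independent-removeAt G {xs} v∈Z v∉xs ind with surviving-rows xs v∉xs
  ... | ys , xs~ys =
    ys , independent-relabel (cutMatrix G Z) (cutMatrix (G - v) (removeAt Z v)) SurvivingRow surviving-column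
           (λ x~y j → cong₂ (adj G) (≡.sym x~y) (≡.sym (punchIn-punchOut (column≢v j)))) xs~ys ind
       , ≡.sym (Pointwise-length xs~ys)
    where
    column≢v : (j : Σ (Fin (suc m)) (_∉ˢ Z)) → v ≢ proj₁ j
    column≢v (j , j∉Z) refl = j∉Z v∈Z

    surviving-column : Σ (Fin (suc m)) (_∉ˢ Z) → Σ (Fin m) (_∉ˢ removeAt Z v)
    surviving-column j = punchOut (column≢v j) , punchOut-∉ (column≢v j) (proj₂ j)

module _ {n : ℕ} (G : Graph n) where

  independent⇒cutRank≥ : ∀ {Z xs} → Independent (cutMatrix G Z) xs →
    ∃ λ t → IsCutRank G Z t × length xs ≤ t
  independent⇒cutRank≥ {Z} = independent⇒rank≥ (_∈? Z) (λ i → ¬? (i ∈? Z)) (adj G)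

  independent-complement : ∀ {X xs} → Independent (cutMatrix G X) xs →
    ∃ λ ys → Independent (cutMatrix G (∁ X)) ys × length xs ≤ length ys
  independent-complement {X} ind
    with independent⇒spanning-extension (_∈? ∁ X) (λ i → ¬? (i ∈? ∁ X)) (adj G)
           ([]-independent (cutMatrix G (∁ X)))
  ... | ys , ind′ , _ , spans =
    ys , ind′ , independent≤spanning-transpose (cutMatrix G X) (cutMatrix G (∁ X))
                  (λ (j , j∉X) → j , x∉p⇒x∈∁p j∉X) (λ (i , i∈X) → i , x∈p⇒x∉∁p i∈X)
                  (λ (i , _) (j , _) → Graph.sym G i j) ind spans

  independent⇒Unique-vertices : ∀ {Z xs} → Independent (cutMatrix G Z) xs → Unique (vertices xs)
  independent⇒Unique-vertices ind = AllPairs.map⁺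
    (AllPairs.map (λ x≉y x≡y → x≉y λ j → cong (λ i → adj G i (proj₁ j)) x≡y)
                  (independent⇒distinct _ ind))

Unique⇒lookup-injective : ∀ {A : Set} {xs : List A} → Unique xs →
  ∀ i j → lookup xs i ≡ lookup xs j → i ≡ j
Unique⇒lookup-injective (_ ∷ _)      zero    zero    _  = refl
Unique⇒lookup-injective (x≢xs ∷ _)   zero    (suc j) eq = ⊥-elim (List.lookup x≢xs (∈-lookup j) eq)
Unique⇒lookup-injective (x≢xs ∷ _)   (suc i) zero    eq = ⊥-elim (List.lookup x≢xs (∈-lookup i) (≡.sym eq))
Unique⇒lookup-injective (_ ∷ unique) (suc i) (suc j) eq = cong suc (Unique⇒lookup-injective unique i j eq)

Unique∧complete⇒length≡ : ∀ {n} {ws : List (Fin n)} → Unique ws → (∀ v → v ∈ₗ ws) → n ≡ length ws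
Unique∧complete⇒length≡ {ws = ws} unique complete = ≤-antisym
  (injective⇒≤ {f = index ∘ complete} λ {v} {v′} eq →
    trans (lookup-index (complete v)) (trans (cong (lookup ws) eq) (≡.sym (lookup-index (complete v′)))))
  (injective⇒≤ {f = lookup ws} (Unique⇒lookup-injective unique _ _))

Enumerates : ∀ {n} → Subset n → List (Fin n) → Set
Enumerates Z ws = Unique ws × (∀ {v} → v ∈ₗ ws → v ∈ˢ Z) × (∀ {v} → v ∈ˢ Z → v ∈ₗ ws)

enumerates-complementary⇒length≡ : ∀ {n} {X : Subset n} {xs ys} →
  Enumerates X xs → Enumerates (∁ X) ys → n ≡ length xs + length ys
enumerates-complementary⇒length≡ {X = X} {xs} {ys}
  (uniqueˣ , insideˣ , coversˣ) (uniqueʸ , insideʸ , coversʸ) =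
  trans (Unique∧complete⇒length≡ (Unique.++⁺ uniqueˣ uniqueʸ disjoint) complete) (length-++ xs)
  where
  disjoint : ∀ {v} → ¬ (v ∈ₗ xs × v ∈ₗ ys)
  disjoint (v∈xs , v∈ys) = x∈∁p⇒x∉p (insideʸ v∈ys) (insideˣ v∈xs)

  complete : ∀ v → v ∈ₗ xs ++ ys
  complete v with v ∈? X
  ... | yes v∈X = ∈-++⁺ˡ (coversˣ v∈X)
  ... | no  v∉X = ∈-++⁺ʳ xs (coversʸ (x∉p⇒x∈∁p v∉X))

minimal⇒independent-rows-cover : ∀ {n k} (G : Graph n) → (∀ v → MaxRhoLe (G - v) k) →
  ∀ {Z xs} → Independent (cutMatrix G Z) xs → k < length xs → ∀ {v} → v ∈ˢ Z → v ∈ₗ vertices xs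
minimal⇒independent-rows-cover {zero} G minimal ind k<xs {()}
minimal⇒independent-rows-cover {suc m} {k} G minimal {Z} {xs} ind k<xs {v} v∈Z
  with any? (v ≟ᶠ_) (vertices xs)
... | yes v∈xs = v∈xs
... | no  v∉xs with independent-removeAt Z G v∈Z (¬Any⇒All¬ xs (v∉xs ∘ Any.map⁺)) ind
...   | ys , ind′ , ys≡xs with independent⇒cutRank≥ (G - v) ind′
...     | t , ρ≡t , ys≤t =
  ⊥-elim (n≮n k (<-≤-trans k<xs (≤-trans (subst (_≤ t) ys≡xs ys≤t) (minimal v _ t ρ≡t))))

minimal⇒enumeration : ∀ {n k} (G : Graph n) → (∀ v → MaxRhoLe (G - v) k) →
  ∀ {Z xs} → Independent (cutMatrix G Z) xs → k < length xs →
  ∃ λ ws → Enumerates Z ws × length ws ≡ suc k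
minimal⇒enumeration G minimal ind k<xs with independent-of-length _ ind k<xs
... | ys , ind′ , ys≡1+k =
  vertices ys ,
  (independent⇒Unique-vertices G ind′ , vertices-⊆ ,
   minimal⇒independent-rows-cover G minimal ind′ (subst (_ <_) (≡.sym ys≡1+k) ≤-refl)) ,
  trans (length-map proj₁ ys) ys≡1+k

minimal⇒size≡ : ∀ {n k} (G : Graph n) → (∀ v → MaxRhoLe (G - v) k) →
  ∀ {X xs} → Independent (cutMatrix G X) xs → k < length xs → n ≡ suc k + suc k
minimal⇒size≡ G minimal ind k<xs
  with minimal⇒enumeration G minimal ind k<xs | independent-complement G ind
... | ws , X-enum , ws≡1+k | ys , ys-independent , xs≤ys
  with minimal⇒enumeration G minimal ys-independent (<-≤-trans k<xs xs≤ys)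
...   | ws′ , ∁X-enum , ws′≡1+k =
  trans (enumerates-complementary⇒length≡ X-enum ∁X-enum) (cong₂ _+_ ws≡1+k ws′≡1+k)

theorem6p1 : (k n : ℕ) (G : Graph n) →
    MaxRhoGt G k →
    (∀ (v : Fin n) → MaxRhoLe (G - v) k) →
    n ≡ 2 * k + 2
theorem6p1 k n G (X , r , ((L , _ , L-linIndep , L≡r) , _) , k<r) minimal =
  trans (minimal⇒size≡ G minimal (linIndepRows⇒independent (cutMatrix G X) {L} L-linIndep)
                                 (subst (k <_) (≡.sym L≡r) k<r))
        (1+k+1+k≡2k+2 k)
  where
  1+k+1+k≡2k+2 : ∀ k → suc k + suc k ≡ 2 * k + 2
  1+k+1+k≡2k+2 = solve-∀
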